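{- If $r\in\mathcal M_{0,0,0}$, then $3r\in\mathcal M_{2,2,2}$. Conversely, if $R\in\mathcal M_{2,2,2}$, then $R/3\in\mathcal M_{0,0,0}$.
   Context: For $(k_1,k_2,k_3)\in\mathbb Z_{\ge0}^3$, the $(k_1,k_2,k_3)$-generalized Markov equation is $x_1^2+x_2^2+x_3^2+k_1x_2x_3+k_2x_3x_1+k_3x_1x_2=(3+k_1+k_2+k_3)x_1x_2x_3$. For $n\in\mathbb Z_{\ge1}$ and $i\in\{1,2,3\}$ put $\Delta(n,i):=((3+k_1+k_2+k_3)n-k_i)^2-4$. The $(k_1,k_2,k_3)$-generalized discrete Markov spectrum is \[\mathcal M_{k_1,k_2,k_3}:=\left\{\frac{\sqrt{\Delta(x_i,i)}}{x_i}\ \middle|\ (x_1,x_2,x_3)\in\mathbb Z_{>0}^3 \text{ solves the }(k_1,k_2,k_3)\text{ -generalized Markov equation},\ i\in\{1,2,3\}\right\}.\] In particular $\mathcal M_{0,0,0}=\{\sqrt{9n^2-4}/n \mid n \text{ a Markov number}\}$ (Markov numbers being the entries of positive integer solutions of $x^2+y^2+z^2=3xyz$), and $\mathcal M_{2,2,2}=\{\sqrt{(9n-2)^2-4}/n\mid n \text{ an entry of a positive integer solution of } x^2+y^2+z^2+2yz+2zx+2xy=9xyz\}$. -}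

module Defs where

open import Data.Nat using (ℕ; _+_; _*_; _∸_; _^_; _<_)
open import Data.Fin using (Fin; zero; suc)
open import Data.Product using (_×_)
open import Relation.Binary.PropositionalEquality using (_≡_)

Triple : Set
Triple = Fin 3 → ℕ

i₁ i₂ i₃ : Fin 3
i₁ = zero
i₂ = suc zero
i₃ = suc (suc zero)

ksum : Triple → ℕ
ksum k = k i₁ + k i₂ + k i₃

GenMarkovEq : Triple → Triple → Set
GenMarkovEq k x =
  x i₁ ^ 2 + x i₂ ^ 2 + x i₃ ^ 2
    + k i₁ * x i₂ * x i₃ + k i₂ * x i₃ * x i₁ + k i₃ * x i₁ * x i₂
  ≡ (3 + ksum k) * x i₁ * x i₂ * x i₃

Solution : Triple → Triple → Set
Solution k x = (0 < x i₁) × (0 < x i₂) × (0 < x i₃) × GenMarkovEq k x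

-- Δ(n,i) = ((3+k₁+k₂+k₃)n − k_i)² − 4.  For n ≥ 1 the inner difference is
-- ≥ 3, so truncated subtraction ∸ agrees with integer subtraction.
Δ : Triple → ℕ → Fin 3 → ℕ
Δ k n i = ((3 + ksum k) * n ∸ k i) ^ 2 ∸ 4

k000 k222 : Triple
k000 _ = 0
k222 _ = 2

{-# OPTIONS --safe #-}
-- Squaring sends a Markov triple (a, b, c) to a solution (a², b², c²) of the (2,2,2)-equation,
-- which reads (u + v + w)² = 9uvw, and (9n² − 2)² − 4 = 9n²((3n)² − 4) makes the spectrum value
-- at n² three times the one at n.  Conversely, every positive solution of (u + v + w)² = 9uvw
-- consists of squares of a Markov triple, by Vieta descent: for u ≥ v ≥ w and u > 1 the other
-- root u′ = 9vw − 2(v + w) − u of the equation in u is positive and below u, because the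
-- quadratic with roots u, u′ takes the value (2v + w)² − 9v²w ≤ 0 at v (strictly if v > 1).
-- If u′ = a′², v = b², w = c² with (a′, b, c) Markov, its Markov partner a = 3bc − a′ satisfies
-- a·a′ = b² + c², so u·u′ = (v + w)² = (a·a′)² gives u = a².
module Submission where

open import Defs
open import Algebra.Properties.CommutativeSemigroup using (xy∙z≈yx∙z; xy∙z≈xz∙y; interchange)
open import Data.Fin using (Fin; zero; suc)
open import Data.Integer.Base as ℤ using (ℤ; +_; 0ℤ; +<+; +≤+)
import Data.Integer.Properties as ℤ
open import Data.Nat.Base as ℕ using (ℕ; zero; suc; z≤n; s≤s)
import Data.Nat.Properties as ℕ
open import Data.Product using (_×_; _,_; ∃-syntax)
open import Data.Sum using (inj₁; inj₂)
open import Relation.Binary.PropositionalEquality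
  using (_≡_; refl; sym; trans; cong; cong₂; subst; subst₂; module ≡-Reasoning)
open import Relation.Nullary using (contradiction)

module Vieta where
  open import Data.Integer.Base using (_+_; _*_; -_; _-_; _≤_; _<_)
  open import Data.Integer.Solver using (module +-*-Solver)
  open +-*-Solver using (solve; _:=_; _:+_; _:*_; _:-_; con; Polynomial)

  markovForm : ℤ → ℤ → ℤ → ℤ
  markovForm a b c = a * a + b * b + c * c - + 3 * a * b * c

  markovForm₂₂₂ : ℤ → ℤ → ℤ → ℤ
  markovForm₂₂₂ u v w = (u + v + w) * (u + v + w) - + 9 * u * v * w

  vieta : ℤ → ℤ → ℤ → ℤ
  vieta a b c = + 3 * b * c - a

  vieta₂₂₂ : ℤ → ℤ → ℤ → ℤ
  vieta₂₂₂ u v w = + 9 * v * w - + 2 * (v + w) - u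

  -- The value at t = v of the quadratic in t with roots u and vieta₂₂₂ u v w.
  δ₂₂₂ : ℤ → ℤ → ℤ
  δ₂₂₂ v w = (+ 2 * v + w) * (+ 2 * v + w) - + 9 * v * v * w

  private
    module Syntax {n : ℕ} where
      P : Set
      P = Polynomial n

      markovFormᴾ : P → P → P → P
      markovFormᴾ a b c = a :* a :+ b :* b :+ c :* c :- con (+ 3) :* a :* b :* c

      markovForm₂₂₂ᴾ : P → P → P → P
      markovForm₂₂₂ᴾ u v w = (u :+ v :+ w) :* (u :+ v :+ w) :- con (+ 9) :* u :* v :* w

      vietaᴾ : P → P → P → P
      vietaᴾ a b c = con (+ 3) :* b :* c :- a

      vieta₂₂₂ᴾ : P → P → P → P
      vieta₂₂₂ᴾ u v w = con (+ 9) :* v :* w :- con (+ 2) :* (v :+ w) :- u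

      δ₂₂₂ᴾ : P → P → P
      δ₂₂₂ᴾ v w = (con (+ 2) :* v :+ w) :* (con (+ 2) :* v :+ w) :- con (+ 9) :* v :* v :* w
    open Syntax

  markovForm-swap₁₂ : ∀ a b c → markovForm b a c ≡ markovForm a b c
  markovForm-swap₁₂ = solve 3 (λ a b c → markovFormᴾ b a c := markovFormᴾ a b c) refl

  markovForm-swap₂₃ : ∀ a b c → markovForm a c b ≡ markovForm a b c
  markovForm-swap₂₃ = solve 3 (λ a b c → markovFormᴾ a c b := markovFormᴾ a b c) refl

  markovForm₂₂₂-swap₁₂ : ∀ u v w → markovForm₂₂₂ v u w ≡ markovForm₂₂₂ u v w
  markovForm₂₂₂-swap₁₂ = solve 3 (λ u v w → markovForm₂₂₂ᴾ v u w := markovForm₂₂₂ᴾ u v w) refl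

  markovForm₂₂₂-swap₂₃ : ∀ u v w → markovForm₂₂₂ u w v ≡ markovForm₂₂₂ u v w
  markovForm₂₂₂-swap₂₃ = solve 3 (λ u v w → markovForm₂₂₂ᴾ u w v := markovForm₂₂₂ᴾ u v w) refl

  markovForm-vieta : ∀ a b c → markovForm (vieta a b c) b c ≡ markovForm a b c
  markovForm-vieta = solve 3 (λ a b c → markovFormᴾ (vietaᴾ a b c) b c := markovFormᴾ a b c) refl

  markovForm₂₂₂-vieta₂₂₂ : ∀ u v w → markovForm₂₂₂ (vieta₂₂₂ u v w) v w ≡ markovForm₂₂₂ u v w
  markovForm₂₂₂-vieta₂₂₂ =
    solve 3 (λ u v w → markovForm₂₂₂ᴾ (vieta₂₂₂ᴾ u v w) v w := markovForm₂₂₂ᴾ u v w) refl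

  private
    drop-vanishing : ∀ {x y f} → f ≡ 0ℤ → x ≡ y - f → x ≡ y
    drop-vanishing {y = y} refl x≡y-0 = trans x≡y-0 (ℤ.+-identityʳ y)

  vieta-product : ∀ a b c → markovForm a b c ≡ 0ℤ → vieta a b c * a ≡ b * b + c * c
  vieta-product a b c eq = drop-vanishing eq (solve 3 (λ a b c →
    vietaᴾ a b c :* a := b :* b :+ c :* c :- markovFormᴾ a b c) refl a b c)

  vieta₂₂₂-product : ∀ u v w → markovForm₂₂₂ u v w ≡ 0ℤ →
                     u * vieta₂₂₂ u v w ≡ (v + w) * (v + w)
  vieta₂₂₂-product u v w eq = drop-vanishing eq (solve 3 (λ u v w →
    u :* vieta₂₂₂ᴾ u v w := (v :+ w) :* (v :+ w) :- markovForm₂₂₂ᴾ u v w) refl u v w)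

  vieta₂₂₂-at-v : ∀ u v w → markovForm₂₂₂ u v w ≡ 0ℤ →
                  (u - v) * (vieta₂₂₂ u v w - v) ≡ δ₂₂₂ v w
  vieta₂₂₂-at-v u v w eq = drop-vanishing eq (solve 3 (λ u v w →
    (u :- v) :* (vieta₂₂₂ᴾ u v w :- v) := δ₂₂₂ᴾ v w :- markovForm₂₂₂ᴾ u v w) refl u v w)

  markovForm₂₂₂[v,v,w]≡0⇒δ₂₂₂≡0 : ∀ v w → markovForm₂₂₂ v v w ≡ 0ℤ → δ₂₂₂ v w ≡ 0ℤ
  markovForm₂₂₂[v,v,w]≡0⇒δ₂₂₂≡0 v w eq =
    trans (sym (vieta₂₂₂-at-v v v w eq)) (cong (_* (vieta₂₂₂ v v w - v)) (ℤ.+-inverseʳ v))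

  i<j⇒0<j-i : ∀ {i j} → i < j → 0ℤ < j - i
  i<j⇒0<j-i {i} {j} i<j = subst (_< j - i) (ℤ.+-inverseʳ i) (ℤ.+-monoˡ-< (- i) i<j)

  i<j⇒i-j<0 : ∀ {i j} → i < j → i - j < 0ℤ
  i<j⇒i-j<0 {i} {j} i<j = subst (i - j <_) (ℤ.+-inverseʳ j) (ℤ.+-monoˡ-< (- j) i<j)

  vieta₂₂₂-positive : ∀ u v w → 0ℤ < u → 0ℤ < v + w → markovForm₂₂₂ u v w ≡ 0ℤ →
                      0ℤ < vieta₂₂₂ u v w
  vieta₂₂₂-positive u v w 0<u 0<v+w eq =
    ℤ.*-cancelˡ-<-nonNeg u {{ℤ.nonNegative (ℤ.<⇒≤ 0<u)}} (begin-strict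
      u * 0ℤ              ≡⟨ ℤ.*-zeroʳ u ⟩
      0ℤ                  ≡⟨ ℤ.*-zeroʳ (v + w) ⟨
      (v + w) * 0ℤ        <⟨ ℤ.*-monoˡ-<-pos (v + w) {{ℤ.positive 0<v+w}} 0<v+w ⟩
      (v + w) * (v + w)   ≡⟨ vieta₂₂₂-product u v w eq ⟨
      u * vieta₂₂₂ u v w  ∎)
    where open ℤ.≤-Reasoning

  vieta₂₂₂-≤ : ∀ u v w → markovForm₂₂₂ u v w ≡ 0ℤ → v < u → δ₂₂₂ v w ≤ 0ℤ →
               vieta₂₂₂ u v w ≤ v
  vieta₂₂₂-≤ u v w eq v<u δ≤0 =
    ℤ.i-j≤0⇒i≤j (ℤ.*-cancelˡ-≤-pos (vieta₂₂₂ u v w - v) 0ℤ (u - v)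
                   {{ℤ.positive (i<j⇒0<j-i v<u)}} (begin
      (u - v) * (vieta₂₂₂ u v w - v)  ≡⟨ vieta₂₂₂-at-v u v w eq ⟩
      δ₂₂₂ v w                        ≤⟨ δ≤0 ⟩
      0ℤ                              ≡⟨ ℤ.*-zeroʳ (u - v) ⟨
      (u - v) * 0ℤ                    ∎))
    where open ℤ.≤-Reasoning

open Vieta

open import Data.Nat.Base using (_+_; _*_; _^_; _∸_; _≤_; _<_)
open import Data.Nat.Solver using (module +-*-Solver)
open +-*-Solver using (solve; _:=_; _:+_; _:*_; _:^_; con)

pos-*³ : ∀ k a b c → + (k * a * b * c) ≡ + k ℤ.* + a ℤ.* + b ℤ.* + c
pos-*³ k a b c = trans (ℤ.pos-* (k * a * b) c)
  (cong (ℤ._* + c) (trans (ℤ.pos-* (k * a) b) (cong (ℤ._* + b) (ℤ.pos-* k a))))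

0<n*n⇒0<n : ∀ {n} → 0 < n * n → 0 < n
0<n*n⇒0<n {suc n} _ = s≤s z≤n

[2v+w]²<9v²w : ∀ {v w} → 0 < w → w ≤ v → 2 ≤ v → (2 * v + w) * (2 * v + w) < 9 * v * v * w
[2v+w]²<9v²w {v} {w} (s≤s z≤n) w≤v 2≤v@(s≤s (s≤s z≤n)) = begin-strict
  (2 * v + w) * (2 * v + w)                      ≡⟨ expand v w ⟩
  4 * (v * v) + 4 * (v * w) + w * w              <⟨ ℕ.+-mono-<-≤ (ℕ.+-mono-≤-<
                                                       (ℕ.*-monoʳ-≤ 4 (ℕ.m≤m*n (v * v) w))
                                                       (ℕ.*-monoʳ-< 4 (ℕ.m<m*n (v * w) v 2≤v)))
                                                     (ℕ.*-monoˡ-≤ w (ℕ.m≤n⇒m≤n*o v w≤v)) ⟩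
  4 * (v * v * w) + 4 * (v * w * v) + v * v * w  ≡⟨ collect v w ⟩
  9 * v * v * w                                  ∎
  where
  open ℕ.≤-Reasoning
  expand : ∀ v w → (2 * v + w) * (2 * v + w) ≡ 4 * (v * v) + 4 * (v * w) + w * w
  expand = solve 2 (λ v w → (con 2 :* v :+ w) :* (con 2 :* v :+ w)
                         := con 4 :* (v :* v) :+ con 4 :* (v :* w) :+ w :* w) refl
  collect : ∀ v w → 4 * (v * v * w) + 4 * (v * w * v) + v * v * w ≡ 9 * v * v * w
  collect = solve 2 (λ v w → con 4 :* (v :* v :* w) :+ con 4 :* (v :* w :* v) :+ v :* v :* w
                          := con 9 :* v :* v :* w) refl

δ₂₂₂<0 : ∀ {v w} → 0 < w → w ≤ v → 2 ≤ v → δ₂₂₂ (+ v) (+ w) ℤ.< 0ℤ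
δ₂₂₂<0 {v} {w} 0<w w≤v 2≤v =
  i<j⇒i-j<0 (subst₂ ℤ._<_ pos-square (pos-*³ 9 v v w) (+<+ ([2v+w]²<9v²w 0<w w≤v 2≤v)))
  where
  pos-square : + ((2 * v + w) * (2 * v + w)) ≡ (+ 2 ℤ.* + v ℤ.+ + w) ℤ.* (+ 2 ℤ.* + v ℤ.+ + w)
  pos-square = trans (ℤ.pos-* (2 * v + w) (2 * v + w))
                     (cong (λ x → x ℤ.* x) (cong (ℤ._+ + w) (ℤ.pos-* 2 v)))

δ₂₂₂≤0 : ∀ {v w} → 0 < w → w ≤ v → δ₂₂₂ (+ v) (+ w) ℤ.≤ 0ℤ
δ₂₂₂≤0 {zero}        (s≤s z≤n) ()
δ₂₂₂≤0 {1}           (s≤s z≤n) (s≤s z≤n) = ℤ.≤-refl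
δ₂₂₂≤0 {suc (suc _)} 0<w       w≤v       = ℤ.<⇒≤ (δ₂₂₂<0 0<w w≤v (s≤s (s≤s z≤n)))

sorted-solution₂₂₂⇒v<u : ∀ {u v w} → 0 < w → w ≤ v → v ≤ u → 2 ≤ u →
                         markovForm₂₂₂ (+ u) (+ v) (+ w) ≡ 0ℤ → v < u
sorted-solution₂₂₂⇒v<u {v = zero} (s≤s z≤n) () _ _ _
sorted-solution₂₂₂⇒v<u {v = 1} _ _ _ 2≤u _ = 2≤u
sorted-solution₂₂₂⇒v<u {v = v@(suc (suc _))} {w} 0<w w≤v v≤u _ eq = ℕ.≤∧≢⇒< v≤u λ { refl →
  ℤ.<-irrefl (markovForm₂₂₂[v,v,w]≡0⇒δ₂₂₂≡0 (+ v) (+ w) eq) (δ₂₂₂<0 0<w w≤v (s≤s (s≤s z≤n))) }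

vieta₂₂₂<u : ∀ {u v w} → 0 < w → w ≤ v → v ≤ u → 2 ≤ u →
             markovForm₂₂₂ (+ u) (+ v) (+ w) ≡ 0ℤ → vieta₂₂₂ (+ u) (+ v) (+ w) ℤ.< + u
vieta₂₂₂<u {u} {v} {w} 0<w w≤v v≤u 2≤u eq =
  ℤ.≤-<-trans (vieta₂₂₂-≤ (+ u) (+ v) (+ w) eq (+<+ v<u) (δ₂₂₂≤0 0<w w≤v)) (+<+ v<u)
  where
  v<u : v < u
  v<u = sorted-solution₂₂₂⇒v<u 0<w w≤v v≤u 2≤u eq

record MarkovSquares (u v w : ℕ) : Set where
  constructor markovSquares
  field
    a b c  : ℕ
    markov : markovForm (+ a) (+ b) (+ c) ≡ 0ℤ
    u≡a*a  : u ≡ a * a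
    v≡b*b  : v ≡ b * b
    w≡c*c  : w ≡ c * c

markovSquares-swap₁₂ : ∀ {u v w} → MarkovSquares v u w → MarkovSquares u v w
markovSquares-swap₁₂ (markovSquares a b c markov v≡a*a u≡b*b w≡c*c) =
  markovSquares b a c (trans (markovForm-swap₁₂ (+ a) (+ b) (+ c)) markov) u≡b*b v≡a*a w≡c*c

markovSquares-swap₂₃ : ∀ {u v w} → MarkovSquares u w v → MarkovSquares u v w
markovSquares-swap₂₃ (markovSquares a b c markov u≡a*a w≡b*b v≡c*c) =
  markovSquares a c b (trans (markovForm-swap₂₃ (+ a) (+ b) (+ c)) markov) u≡a*a v≡c*c w≡b*b

record PositiveSolution₂₂₂ (u v w : ℕ) : Set where
  field
    0<u      : 0 < u
    0<v      : 0 < v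
    0<w      : 0 < w
    equation : markovForm₂₂₂ (+ u) (+ v) (+ w) ≡ 0ℤ

open PositiveSolution₂₂₂

positiveSolution₂₂₂-swap₁₂ : ∀ {u v w} → PositiveSolution₂₂₂ u v w → PositiveSolution₂₂₂ v u w
positiveSolution₂₂₂-swap₁₂ {u} {v} {w} sol = record
  { 0<u = 0<v sol ; 0<v = 0<u sol ; 0<w = 0<w sol
  ; equation = trans (markovForm₂₂₂-swap₁₂ (+ u) (+ v) (+ w)) (equation sol) }

positiveSolution₂₂₂-swap₂₃ : ∀ {u v w} → PositiveSolution₂₂₂ u v w → PositiveSolution₂₂₂ u w v
positiveSolution₂₂₂-swap₂₃ {u} {v} {w} sol = record
  { 0<u = 0<u sol ; 0<v = 0<w sol ; 0<w = 0<v sol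
  ; equation = trans (markovForm₂₂₂-swap₂₃ (+ u) (+ v) (+ w)) (equation sol) }

vieta-natural : ∀ a b c → 0 < a → markovForm (+ a) (+ b) (+ c) ≡ 0ℤ →
                ∃[ n ] markovForm (+ n) (+ b) (+ c) ≡ 0ℤ × n * a ≡ b * b + c * c
vieta-natural a b c 0<a eq = ℤ.∣ a′ ∣ , markov′ , ℤ.+-injective n*a≡b*b+c*c
  where
  a′ : ℤ
  a′ = vieta (+ a) (+ b) (+ c)
  a′*a≡b*b+c*c : a′ ℤ.* + a ≡ + (b * b + c * c)
  a′*a≡b*b+c*c = trans (vieta-product (+ a) (+ b) (+ c) eq)
                       (sym (cong₂ ℤ._+_ (ℤ.pos-* b b) (ℤ.pos-* c c)))
  +n≡a′ : + ℤ.∣ a′ ∣ ≡ a′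
  +n≡a′ = ℤ.0≤i⇒+∣i∣≡i (ℤ.*-cancelʳ-≤-pos 0ℤ a′ (+ a) {{ℤ.positive (+<+ 0<a)}}
                          (subst (0ℤ ℤ.≤_) (sym a′*a≡b*b+c*c) (+≤+ z≤n)))
  markov′ : markovForm (+ ℤ.∣ a′ ∣) (+ b) (+ c) ≡ 0ℤ
  markov′ = subst (λ x → markovForm x (+ b) (+ c) ≡ 0ℤ) (sym +n≡a′)
                  (trans (markovForm-vieta (+ a) (+ b) (+ c)) eq)
  n*a≡b*b+c*c : + (ℤ.∣ a′ ∣ * a) ≡ + (b * b + c * c)
  n*a≡b*b+c*c = trans (ℤ.pos-* ℤ.∣ a′ ∣ a) (trans (cong (ℤ._* + a) +n≡a′) a′*a≡b*b+c*c)

vieta₂₂₂-natural : ∀ {u v w} → w ≤ v → v ≤ u → 2 ≤ u → PositiveSolution₂₂₂ u v w →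
                   ∃[ m ] m < u × PositiveSolution₂₂₂ m v w × u * m ≡ (v + w) * (v + w)
vieta₂₂₂-natural {u} {v} {w} w≤v v≤u 2≤u sol = m , m<u , sol′ , ℤ.+-injective u*m≡[v+w]²
  where
  u′ : ℤ
  u′ = vieta₂₂₂ (+ u) (+ v) (+ w)
  0<u′ : 0ℤ ℤ.< u′
  0<u′ = vieta₂₂₂-positive (+ u) (+ v) (+ w) (+<+ (0<u sol)) (+<+ (ℕ.<-≤-trans (0<v sol) (ℕ.m≤m+n v w)))
                           (equation sol)
  m : ℕ
  m = ℤ.∣ u′ ∣
  +m≡u′ : + m ≡ u′
  +m≡u′ = ℤ.0≤i⇒+∣i∣≡i (ℤ.<⇒≤ 0<u′)
  m<u : m < u
  m<u = ℤ.drop‿+<+ (subst (ℤ._< + u) (sym +m≡u′) (vieta₂₂₂<u (0<w sol) w≤v v≤u 2≤u (equation sol)))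
  sol′ : PositiveSolution₂₂₂ m v w
  sol′ = record
    { 0<u = ℤ.drop‿+<+ (subst (0ℤ ℤ.<_) (sym +m≡u′) 0<u′) ; 0<v = 0<v sol ; 0<w = 0<w sol
    ; equation = subst (λ x → markovForm₂₂₂ x (+ v) (+ w) ≡ 0ℤ) (sym +m≡u′)
                       (trans (markovForm₂₂₂-vieta₂₂₂ (+ u) (+ v) (+ w)) (equation sol)) }
  u*m≡[v+w]² : + (u * m) ≡ + ((v + w) * (v + w))
  u*m≡[v+w]² = begin
    + (u * m)                ≡⟨ ℤ.pos-* u m ⟩
    + u ℤ.* + m              ≡⟨ cong (+ u ℤ.*_) +m≡u′ ⟩
    + u ℤ.* u′               ≡⟨ vieta₂₂₂-product (+ u) (+ v) (+ w) (equation sol) ⟩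
    + (v + w) ℤ.* + (v + w)  ≡⟨ ℤ.pos-* (v + w) (v + w) ⟨
    + ((v + w) * (v + w))    ∎
    where open ≡-Reasoning

markovSquares-vieta : ∀ {u m v w} → 0 < m → u * m ≡ (v + w) * (v + w) →
                      MarkovSquares m v w → MarkovSquares u v w
markovSquares-vieta {u} {m} {v} {w} 0<m u*m≡[v+w]² (markovSquares a b c markov m≡a*a v≡b*b w≡c*c) =
  let n , markov′ , n*a≡b*b+c*c = vieta-natural a b c (0<n*n⇒0<n 0<a*a) markov
  in markovSquares n b c markov′ (u≡n*n {n} n*a≡b*b+c*c) v≡b*b w≡c*c
  where
  open ≡-Reasoning
  0<a*a : 0 < a * a
  0<a*a = subst (0 <_) m≡a*a 0<m
  u≡n*n : ∀ {n} → n * a ≡ b * b + c * c → u ≡ n * n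
  u≡n*n {n} n*a≡b*b+c*c = ℕ.*-cancelʳ-≡ u (n * n) (a * a) {{ℕ.>-nonZero 0<a*a}} (begin
    u * (a * a)                        ≡⟨ cong (u *_) m≡a*a ⟨
    u * m                              ≡⟨ u*m≡[v+w]² ⟩
    (v + w) * (v + w)                  ≡⟨ cong₂ (λ p q → (p + q) * (p + q)) v≡b*b w≡c*c ⟩
    (b * b + c * c) * (b * b + c * c)  ≡⟨ cong (λ p → p * p) n*a≡b*b+c*c ⟨
    (n * a) * (n * a)                  ≡⟨ interchange ℕ.*-commutativeSemigroup n a n a ⟩
    (n * n) * (a * a)                  ∎)

wlog-sorted : ∀ {ℓ} (P : ℕ → ℕ → ℕ → Set ℓ) →
              (∀ {u v w} → P v u w → P u v w) → (∀ {u v w} → P u w v → P u v w) →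
              (∀ {u v w} → w ≤ v → v ≤ u → P u v w) → ∀ u v w → P u v w
wlog-sorted P swap₁₂ swap₂₃ sorted u v w with ℕ.≤-total w v | ℕ.≤-total v u | ℕ.≤-total w u
... | inj₁ w≤v | inj₁ v≤u | _        = sorted w≤v v≤u
... | inj₁ w≤v | inj₂ u≤v | inj₁ w≤u = swap₁₂ (sorted w≤u u≤v)
... | inj₁ w≤v | inj₂ u≤v | inj₂ u≤w = swap₁₂ (swap₂₃ (sorted u≤w w≤v))
... | inj₂ v≤w | inj₁ v≤u | inj₁ w≤u = swap₂₃ (sorted v≤w w≤u)
... | inj₂ v≤w | inj₁ v≤u | inj₂ u≤w = swap₂₃ (swap₁₂ (sorted v≤u u≤w))
... | inj₂ v≤w | inj₂ u≤v | _        = swap₁₂ (swap₂₃ (swap₁₂ (sorted u≤v v≤w)))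

SquaresBelow : ℕ → ℕ → ℕ → ℕ → Set
SquaresBelow s u v w = u + v + w ≤ s → PositiveSolution₂₂₂ u v w → MarkovSquares u v w

squaresBelow-swap₁₂ : ∀ {s u v w} → SquaresBelow s v u w → SquaresBelow s u v w
squaresBelow-swap₁₂ {s} {u} {v} {w} squares u+v+w≤s sol = markovSquares-swap₁₂
  (squares (subst (_≤ s) (xy∙z≈yx∙z ℕ.+-commutativeSemigroup u v w) u+v+w≤s)
           (positiveSolution₂₂₂-swap₁₂ sol))

squaresBelow-swap₂₃ : ∀ {s u v w} → SquaresBelow s u w v → SquaresBelow s u v w
squaresBelow-swap₂₃ {s} {u} {v} {w} squares u+v+w≤s sol = markovSquares-swap₂₃
  (squares (subst (_≤ s) (xy∙z≈xz∙y ℕ.+-commutativeSemigroup u v w) u+v+w≤s)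
           (positiveSolution₂₂₂-swap₂₃ sol))

sortedDescent : ∀ {s} → (∀ {u v w} → SquaresBelow s u v w) →
                ∀ {u v w} → w ≤ v → v ≤ u → SquaresBelow (suc s) u v w
sortedDescent _ {w = zero} _ _ _ sol = contradiction (0<w sol) ℕ.n≮0
sortedDescent _ {1} {1} {1} _ _ _ _ = markovSquares 1 1 1 refl refl refl refl
sortedDescent _ {1} {suc (suc _)} _ (s≤s ()) _ _
sortedDescent _ {1} {1} {suc (suc _)} (s≤s ()) _ _ _
sortedDescent {s} descend {u@(suc (suc _))} {v} {w} w≤v v≤u u+v+w≤1+s sol =
  let m , m<u , sol′ , u*m≡[v+w]² = vieta₂₂₂-natural w≤v v≤u (s≤s (s≤s z≤n)) sol
      m+v+w≤s : m + v + w ≤ s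
      m+v+w≤s = ℕ.s≤s⁻¹ (ℕ.<-≤-trans (ℕ.+-monoˡ-< w (ℕ.+-monoˡ-< v m<u)) u+v+w≤1+s)
  in markovSquares-vieta (0<u sol′) u*m≡[v+w]² (descend m+v+w≤s sol′)

descent : ∀ s {u v w} → SquaresBelow s u v w
descent zero {zero} _ sol = contradiction (0<u sol) ℕ.n≮0
descent (suc s) {u} {v} {w} =
  wlog-sorted (SquaresBelow (suc s)) squaresBelow-swap₁₂ squaresBelow-swap₂₃
              (sortedDescent (descent s)) u v w

triple : ℕ → ℕ → ℕ → Triple
triple a b c zero             = a
triple a b c (suc zero)       = b
triple a b c (suc (suc zero)) = c

GenMarkovEq-k222⇒markovForm₂₂₂≡0 : ∀ y → GenMarkovEq k222 y → markovForm₂₂₂ (+ y i₁) (+ y i₂) (+ y i₃) ≡ 0ℤ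
GenMarkovEq-k222⇒markovForm₂₂₂≡0 y eq = ℤ.i≡j⇒i-j≡0 (begin
  (+ u ℤ.+ + v ℤ.+ + w) ℤ.* (+ u ℤ.+ + v ℤ.+ + w)  ≡⟨ ℤ.pos-* (u + v + w) (u + v + w) ⟨
  + ((u + v + w) * (u + v + w))                    ≡⟨ cong +_ (trans (square-of-sum u v w) eq) ⟩
  + (9 * u * v * w)                                ≡⟨ pos-*³ 9 u v w ⟩
  + 9 ℤ.* + u ℤ.* + v ℤ.* + w                      ∎)
  where
  open ≡-Reasoning
  u v w : ℕ
  u = y i₁
  v = y i₂
  w = y i₃
  square-of-sum : ∀ u v w → (u + v + w) * (u + v + w) ≡
                  u ^ 2 + v ^ 2 + w ^ 2 + 2 * v * w + 2 * w * u + 2 * u * v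
  square-of-sum = solve 3 (λ u v w → (u :+ v :+ w) :* (u :+ v :+ w) :=
    u :^ 2 :+ v :^ 2 :+ w :^ 2 :+ con 2 :* v :* w :+ con 2 :* w :* u :+ con 2 :* u :* v) refl

markovForm≡0⇒GenMarkovEq-k000 : ∀ a b c → markovForm (+ a) (+ b) (+ c) ≡ 0ℤ → GenMarkovEq k000 (triple a b c)
markovForm≡0⇒GenMarkovEq-k000 a b c eq = trans (sum-of-squares a b c) (ℤ.+-injective (begin
  + (a * a + b * b + c * c)                  ≡⟨ cong₂ ℤ._+_ (cong₂ ℤ._+_ (ℤ.pos-* a a) (ℤ.pos-* b b))
                                                             (ℤ.pos-* c c) ⟩
  + a ℤ.* + a ℤ.+ + b ℤ.* + b ℤ.+ + c ℤ.* + c  ≡⟨ ℤ.i-j≡0⇒i≡j _ _ eq ⟩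
  + 3 ℤ.* + a ℤ.* + b ℤ.* + c                  ≡⟨ pos-*³ 3 a b c ⟨
  + (3 * a * b * c)                          ∎))
  where
  open ≡-Reasoning
  sum-of-squares : ∀ a b c → a ^ 2 + b ^ 2 + c ^ 2 + 0 * b * c + 0 * c * a + 0 * a * b ≡
                   a * a + b * b + c * c
  sum-of-squares = solve 3 (λ a b c →
    a :^ 2 :+ b :^ 2 :+ c :^ 2 :+ con 0 :* b :* c :+ con 0 :* c :* a :+ con 0 :* a :* b :=
    a :* a :+ b :* b :+ c :* c) refl

squares-of-markov-solution : ∀ x → Solution k000 x → Solution k222 (λ i → x i ^ 2)
squares-of-markov-solution x (0<a , 0<b , 0<c , eq) =
  square-positive 0<a , square-positive 0<b , square-positive 0<c ,
  trans (square-expansion a b c) (trans (cong (_^ 2) eq) (square-of-product a b c))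
  where
  a b c : ℕ
  a = x i₁
  b = x i₂
  c = x i₃
  square-positive : ∀ {n} → 0 < n → 0 < n ^ 2
  square-positive {n} 0<n = ℕ.m^n>0 n {{ℕ.>-nonZero 0<n}} 2
  square-expansion : ∀ a b c →
    (a ^ 2) ^ 2 + (b ^ 2) ^ 2 + (c ^ 2) ^ 2 + 2 * b ^ 2 * c ^ 2 + 2 * c ^ 2 * a ^ 2 + 2 * a ^ 2 * b ^ 2 ≡
    (a ^ 2 + b ^ 2 + c ^ 2 + 0 * b * c + 0 * c * a + 0 * a * b) ^ 2
  square-expansion = solve 3 (λ a b c →
    (a :^ 2) :^ 2 :+ (b :^ 2) :^ 2 :+ (c :^ 2) :^ 2
      :+ con 2 :* b :^ 2 :* c :^ 2 :+ con 2 :* c :^ 2 :* a :^ 2 :+ con 2 :* a :^ 2 :* b :^ 2 :=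
    (a :^ 2 :+ b :^ 2 :+ c :^ 2 :+ con 0 :* b :* c :+ con 0 :* c :* a :+ con 0 :* a :* b) :^ 2) refl
  square-of-product : ∀ a b c → (3 * a * b * c) ^ 2 ≡ 9 * a ^ 2 * b ^ 2 * c ^ 2
  square-of-product = solve 3 (λ a b c →
    (con 3 :* a :* b :* c) :^ 2 := con 9 :* a :^ 2 :* b :^ 2 :* c :^ 2) refl

markov-square-roots : ∀ y → Solution k222 y → ∃[ x ] Solution k000 x × (∀ j → y j ≡ x j ^ 2)
markov-square-roots y (0<u , 0<v , 0<w , eq) =
  let markovSquares a b c markov u≡a*a v≡b*b w≡c*c =
        descent (y i₁ + y i₂ + y i₃) ℕ.≤-refl
                (record { 0<u = 0<u ; 0<v = 0<v ; 0<w = 0<w ; equation = GenMarkovEq-k222⇒markovForm₂₂₂≡0 y eq })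
  in triple a b c ,
     (root-positive a u≡a*a 0<u , root-positive b v≡b*b 0<v , root-positive c w≡c*c 0<w ,
      markovForm≡0⇒GenMarkovEq-k000 a b c markov) ,
     λ { zero → squared a u≡a*a ; (suc zero) → squared b v≡b*b ; (suc (suc zero)) → squared c w≡c*c }
  where
  root-positive : ∀ {n} r → n ≡ r * r → 0 < n → 0 < r
  root-positive r n≡r*r 0<n = 0<n*n⇒0<n (subst (0 <_) n≡r*r 0<n)
  squared : ∀ {n} r → n ≡ r * r → n ≡ r ^ 2
  squared r n≡r*r = trans n≡r*r (cong (r *_) (sym (ℕ.*-identityʳ r)))

[m∸2]²∸4≡[m∸4]*m : ∀ m → (m ∸ 2) ^ 2 ∸ 4 ≡ (m ∸ 4) * m
[m∸2]²∸4≡[m∸4]*m 0 = refl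
[m∸2]²∸4≡[m∸4]*m 1 = refl
[m∸2]²∸4≡[m∸4]*m 2 = refl
[m∸2]²∸4≡[m∸4]*m 3 = refl
[m∸2]²∸4≡[m∸4]*m (suc (suc (suc (suc t)))) = begin
  (2 + t) ^ 2 ∸ 4      ≡⟨ cong (_∸ 4) (solve 1 (λ t → (con 2 :+ t) :^ 2 := con 4 :+ t :* (con 4 :+ t)) refl t) ⟩
  4 + t * (4 + t) ∸ 4  ≡⟨ ℕ.m+n∸m≡n 4 (t * (4 + t)) ⟩
  t * (4 + t)          ∎
  where open ≡-Reasoning

Δ-k222-square : ∀ n i j → Δ k222 (n ^ 2) j ≡ Δ k000 n i * (9 * n ^ 2)
Δ-k222-square n i j = begin
  (9 * n ^ 2 ∸ 2) ^ 2 ∸ 4        ≡⟨ [m∸2]²∸4≡[m∸4]*m (9 * n ^ 2) ⟩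
  (9 * n ^ 2 ∸ 4) * (9 * n ^ 2)  ≡⟨ cong (λ m → (m ∸ 4) * (9 * n ^ 2))
                                         (solve 1 (λ n → con 9 :* n :^ 2 := (con 3 :* n) :^ 2) refl n) ⟩
  ((3 * n) ^ 2 ∸ 4) * (9 * n ^ 2) ∎
  where open ≡-Reasoning

spectrum-square : ∀ n i j → 9 * Δ k000 n i * (n ^ 2) ^ 2 ≡ Δ k222 (n ^ 2) j * n ^ 2
spectrum-square n i j = begin
  9 * Δ k000 n i * (n ^ 2) ^ 2      ≡⟨ solve 2 (λ d n → con 9 :* d :* (n :^ 2) :^ 2 :=
                                                        d :* (con 9 :* n :^ 2) :* n :^ 2) refl (Δ k000 n i) n ⟩
  Δ k000 n i * (9 * n ^ 2) * n ^ 2  ≡⟨ cong (_* n ^ 2) (Δ-k222-square n i j) ⟨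
  Δ k222 (n ^ 2) j * n ^ 2          ∎
  where open ≡-Reasoning

theorem6p9 :
    ((x : Triple) → Solution k000 x → (i : Fin 3) →
      ∃[ y ] ∃[ j ] (Solution k222 y ×
        9 * Δ k000 (x i) i * y j ^ 2 ≡ Δ k222 (y j) j * x i ^ 2))
    ×
    ((y : Triple) → Solution k222 y → (j : Fin 3) →
      ∃[ x ] ∃[ i ] (Solution k000 x ×
        9 * Δ k000 (x i) i * y j ^ 2 ≡ Δ k222 (y j) j * x i ^ 2))
theorem6p9 =
  (λ x sol i → (λ j → x j ^ 2) , i , squares-of-markov-solution x sol , spectrum-square (x i) i i) ,
  (λ y sol j → let x , solution , y≡x² = markov-square-roots y sol in
    x , j , solution ,
    subst (λ z → 9 * Δ k000 (x j) j * z ^ 2 ≡ Δ k222 z j * x j ^ 2) (sym (y≡x² j))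
          (spectrum-square (x j) j j))
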